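{- Let $d$ be an odd integer. Then $U=\{(0,0)\}\cup\{(e,f)\in\mathcal{B}\mid f=d\}$ is maximal avoidable in $\mathcal{B}$.
   Context: The bicyclic inverse semigroup is $\mathcal{B}=\{(a,b)\in\mathbb{Z}\times\mathbb{Z}\mid a\ge 0,\ a+b\ge 0\}$ with multiplication $(a,b)(c,d)=(\max\{c+d,a\}-d,\ b+d)$. A subset $U\subseteq\mathcal{B}$ is avoidable if $\mathcal{B}$ can be partitioned into two sets $A$ and $B$ such that no element of $U$ is a product $st$ of two distinct elements $s\ne t$ both in $A$ or both in $B$. $U$ is maximal avoidable if it is avoidable and not properly contained in any avoidable subset of $\mathcal{B}$. -}

module Defs where

open import Data.Integer using (ℤ; +_; _+_; _-_; _*_; _≤_; _⊔_; +0)
open import Data.Product using (Σ; _×_; _,_; proj₁; proj₂; ∃-syntax)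
open import Data.Bool using (Bool)
open import Data.Sum using (_⊎_)
open import Relation.Binary.PropositionalEquality using (_≡_; _≢_)
open import Relation.Nullary using (¬_)
open import Level using (0ℓ)
open import Relation.Unary using (Pred; _⊆_; _∈_)

-- The bicyclic inverse semigroup: pairs (a , b) of integers with a ≥ 0 and a + b ≥ 0.
record 𝓑 : Set where
  constructor ⟨_,_∣_,_⟩
  field
    fst  : ℤ
    snd  : ℤ
    fst≥0 : + 0 ≤ fst
    sum≥0 : + 0 ≤ fst + snd
open 𝓑 public

-- Underlying pair of integers (used for equality / distinctness of elements).
pair : 𝓑 → ℤ × ℤ
pair x = fst x , snd x

mulℤ : ℤ × ℤ → ℤ × ℤ → ℤ × ℤ
mulℤ (a , b) (c , d) = ((c + d) ⊔ a) - d , b + d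

Subset : Set₁
Subset = Pred 𝓑 0ℓ

IsProduct : 𝓑 → 𝓑 → 𝓑 → Set
IsProduct s t x = pair x ≡ mulℤ (pair s) (pair t)

-- A 2-partition {A , B} of 𝓑 is given by a colouring χ : 𝓑 → Bool
-- (A = χ⁻¹ true, B = χ⁻¹ false).
Avoidable : Subset → Set
Avoidable U = Σ (𝓑 → Bool) λ χ →
  (s t x : 𝓑) → pair s ≢ pair t → χ s ≡ χ t → IsProduct s t x → ¬ (x ∈ U)

MaximalAvoidable : Subset → Set₁
MaximalAvoidable U = Avoidable U × ((V : Subset) → U ⊆ V → Avoidable V → V ⊆ U)

Odd : ℤ → Set
Odd d = Σ ℤ λ k → d ≡ + 1 + + 2 * k

U-odd : ℤ → Subset
U-odd d x = (pair x ≡ (+ 0 , + 0)) ⊎ (snd x ≡ d)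

module Submission where

-- Colour an element by g(snd) for a colouring g : ℤ → Bool that
-- separates every pair {f , d - f} and every pair {n , -n} with n ≠ 0.  A product
-- s t has second coordinate snd s + snd t, so a product with second coordinate d
-- has differently coloured factors; and a product ⟨0,0⟩ of distinct factors has
-- factors with second coordinates -n and n for some n > 0.  For d = 2k+1 > 0 such
-- a g colours n ≥ 1 by whether n mod d lies in 0..k, 0 by false, and negative
-- integers opposite to their absolute value; for d < 0 the colouring for -d is
-- reflected.
--
-- Let V ⊇ U be avoided by a colouring χ.  Products that land in U
-- force χ to depend only on the second coordinate, and to be invariant under the
-- shift y ↦ y + d for y ≠ 0.  Every ⟨e , f⟩ ∈ V is an absorbing product
-- (p , b)(e , b') = (e , b + b'), with p ≤ e + b'; choosing b = b' when f is even
-- and b' = b ± d when f is odd exhibits it as a product of distinct factors of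
-- the same colour unless ⟨e , f⟩ ∈ U.

open import Defs

open import Data.Bool using (Bool; true; false; not)
open import Data.Bool.Properties using (not-involutive; not-¬; ¬-not)
open import Data.Empty using (⊥-elim)
open import Data.Integer using (ℤ; +≤+; +_; -[1+_]; _+_; _-_; _*_; -_; _≤_; _⊔_; _≟_; _≤?_)
import Data.Integer.Properties as ℤ
open import Data.Integer.DivMod using (a≡a%n+[a/n]*n; n%d<d) renaming (_%_ to _%ℤ_; _/_ to _/ℤ_)
open import Data.Integer.Tactic.RingSolver using (solve-∀)
open import Data.Nat as ℕ using (ℕ; zero; suc; _∸_)
import Data.Nat.Properties as ℕ
open import Data.Nat.DivMod using (_%_; n%n≡0; [m+n]%n≡m%n; m<n⇒m%n≡m)
open import Data.Product using (_,_; _×_; proj₁; proj₂; ∃-syntax)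
open import Data.Sum using (_⊎_; inj₁; inj₂)
open import Function using (_∘_; mk⇔)
open import Relation.Binary.PropositionalEquality
open import Relation.Nullary using (yes; no; does; ¬_; ¬?)
open import Relation.Nullary.Decidable using (does-⇔)
open import Relation.Unary using (_⊆_; _∈_)

≤-by : ∀ {i j} k → + 0 ≤ k → j ≡ i + k → i ≤ j
≤-by {i} k 0≤k refl = subst (_≤ i + k) (ℤ.+-identityʳ i) (ℤ.+-monoʳ-≤ i 0≤k)

both-differ : ∀ {a b c : Bool} → a ≢ c → b ≢ c → a ≡ b
both-differ a≢c b≢c = trans (¬-not a≢c) (sym (¬-not b≢c))

half-nonneg : ∀ y → + 0 ≤ y + y → + 0 ≤ y
half-nonneg (+ n)    _  = +≤+ ℕ.z≤n
half-nonneg -[1+ n ] ()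

double≢odd : ∀ z k → z + z ≢ + 1 + + 2 * k
double≢odd z k eq = double≢1 (z - k) (trans (shift z k) (trans (cong (_- + 2 * k) eq) (cancel k)))
  where
  shift : ∀ z k → (z - k) + (z - k) ≡ (z + z) - + 2 * k
  shift = solve-∀
  cancel : ∀ k → (+ 1 + + 2 * k) - + 2 * k ≡ + 1
  cancel = solve-∀
  double≢1 : ∀ w → w + w ≢ + 1
  double≢1 (+ zero)  ()
  double≢1 (+ suc n) eq = ℕ.0≢1+n (sym (trans (sym (ℕ.+-suc n n)) (ℕ.suc-injective (ℤ.+-injective eq))))
  double≢1 -[1+ n ]  ()

odd-sign : ∀ d → Odd d → ∃[ k ] (d ≡ + suc (k ℕ.+ k) ⊎ d ≡ - + suc (k ℕ.+ k))
odd-sign _ (+ k , refl)    = k , inj₁ (positive (+ k))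
  where
  positive : ∀ x → + 1 + + 2 * x ≡ + 1 + (x + x)
  positive = solve-∀
odd-sign _ (-[1+ j ] , refl) = j , inj₂ (negative (+ j))
  where
  negative : ∀ x → + 1 + + 2 * (- (+ 1 + x)) ≡ - (+ 1 + (x + x))
  negative = solve-∀

halve : ∀ d → Odd d → ∀ f → ∃[ b ] (f ≡ b + b ⊎ f ≡ b + (b + d))
halve d (k , refl) f with f %ℤ + 2 | f /ℤ + 2 | a≡a%n+[a/n]*n f (+ 2) | n%d<d f (+ 2)
... | zero          | q | f≡ | _ = q , inj₁ (trans f≡ (even q))
  where
  even : ∀ q → + 0 + q * + 2 ≡ q + q
  even = solve-∀
... | suc zero      | q | f≡ | _ = q - k , inj₂ (trans f≡ (odd q k))
  where
  odd : ∀ q k → + 1 + q * + 2 ≡ (q - k) + ((q - k) + (+ 1 + + 2 * k))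
  odd = solve-∀
... | suc (suc _)   | _ | _  | ℕ.s≤s (ℕ.s≤s ())

record Separating (d : ℤ) (g : ℤ → Bool) : Set where
  field
    reflect : ∀ f → g (d - f) ≡ not (g f)
    negate  : ∀ n → g -[1+ n ] ≡ not (g (+ suc n))

module PositiveOdd (k : ℕ) where
  m : ℕ
  m = suc (k ℕ.+ k)

  h : ℕ → Bool
  h zero    = false
  h (suc n) = does (suc n % m ℕ.≤? k)

  complementary : ∀ a b → a ℕ.+ b ≡ m → does (b ℕ.≤? k) ≡ not (does (a ℕ.≤? k))
  complementary a b a+b≡m = does-⇔ (mk⇔ b≤k⇒a≰k a≰k⇒b≤k) (b ℕ.≤? k) (¬? (a ℕ.≤? k))
    where
    b≤k⇒a≰k : b ℕ.≤ k → ¬ a ℕ.≤ k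
    b≤k⇒a≰k b≤k a≤k = ℕ.<-irrefl a+b≡m (ℕ.s≤s (ℕ.+-mono-≤ a≤k b≤k))
    a≰k⇒b≤k : ¬ a ℕ.≤ k → b ℕ.≤ k
    a≰k⇒b≤k a≰k = ℕ.+-cancelˡ-≤ (suc k) b k (subst (suc k ℕ.+ b ℕ.≤_) a+b≡m (ℕ.+-monoˡ-≤ b (ℕ.≰⇒> a≰k)))

  h-m : ∀ {n} → n ≡ m → h n ≡ true
  h-m refl = cong (λ r → does (r ℕ.≤? k)) (n%n≡0 m)

  h-split : ∀ a b → a ℕ.+ b ≡ m → h b ≡ not (h a)
  h-split zero    b       b≡m   = h-m b≡m
  h-split (suc a) zero    a+0≡m = cong not (sym (h-m (trans (sym (ℕ.+-identityʳ (suc a))) a+0≡m)))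
  h-split (suc a) (suc b) a+b≡m = begin
    h (suc b)                    ≡⟨ cong (λ r → does (r ℕ.≤? k)) (m<n⇒m%n≡m b<m) ⟩
    does (suc b ℕ.≤? k)          ≡⟨ complementary (suc a) (suc b) a+b≡m ⟩
    not (does (suc a ℕ.≤? k))    ≡⟨ cong (λ r → not (does (r ℕ.≤? k))) (m<n⇒m%n≡m a<m) ⟨
    not (h (suc a))              ∎
    where
    open ≡-Reasoning
    b<m : suc b ℕ.< m
    b<m = subst (suc b ℕ.<_) a+b≡m (ℕ.m<n+m (suc b) ℕ.z<s)
    a<m : suc a ℕ.< m
    a<m = subst (suc a ℕ.<_) a+b≡m (ℕ.m<m+n (suc a) ℕ.z<s)

  h-shift : ∀ n → h (m ℕ.+ suc n) ≡ h (suc n)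
  h-shift n = trans (cong h (ℕ.+-comm m (suc n))) (cong (λ r → does (r ℕ.≤? k)) ([m+n]%n≡m%n (suc n) m))

  g : ℤ → Bool
  g (+ n)    = h n
  g -[1+ n ] = not (h (suc n))

  -- g separates f from m - f: for 0 ≤ f ≤ m by h-split, otherwise by periodicity.
  g-reflect : ∀ f → g (+ m - f) ≡ not (g f)
  g-reflect (+ n) with n ℕ.≤? m
  ... | yes n≤m = begin
    g (+ m - + n)  ≡⟨ cong g (trans (ℤ.m-n≡m⊖n m n) (ℤ.⊖-≥ n≤m)) ⟩
    h (m ∸ n)      ≡⟨ h-split n (m ∸ n) (ℕ.m+[n∸m]≡n n≤m) ⟩
    not (h n)      ∎
    where open ≡-Reasoning
  ... | no n≰m with ℕ.m≤n⇒∃[o]m+o≡n (ℕ.≰⇒> n≰m)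
  ...   | j , refl = begin
    g (+ m - + suc (m ℕ.+ j))  ≡⟨ cong g (beyond (+ m) (+ j)) ⟩
    not (h (suc j))            ≡⟨ cong not (h-shift j) ⟨
    not (h (m ℕ.+ suc j))      ≡⟨ cong (not ∘ h) (ℕ.+-suc m j) ⟩
    not (h (suc (m ℕ.+ j)))    ∎
    where
    open ≡-Reasoning
    beyond : ∀ x y → x - (+ 1 + (x + y)) ≡ - (+ 1 + y)
    beyond = solve-∀
  g-reflect -[1+ n ] = trans (h-shift n) (sym (not-involutive (h (suc n))))

  separating : Separating (+ m) g
  separating = record { reflect = g-reflect ; negate = λ _ → refl }

separating-neg : ∀ {d g} → Separating d g → Separating (- d) (g ∘ -_)
separating-neg {d} {g} sep = record { reflect = reflect′ ; negate = negate′ }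
  where
  open Separating sep
  reflect′ : ∀ f → g (- (- d - f)) ≡ not (g (- f))
  reflect′ f = trans (cong g (mirror d f)) (reflect (- f))
    where
    mirror : ∀ d f → - (- d - f) ≡ d - (- f)
    mirror = solve-∀
  negate′ : ∀ n → g (+ suc n) ≡ not (g -[1+ n ])
  negate′ n = sym (trans (cong not (negate n)) (not-involutive (g (+ suc n))))

separating : ∀ d → Odd d → ∃[ g ] Separating d g
separating d d-odd with odd-sign d d-odd
... | k , inj₁ refl = PositiveOdd.g k , PositiveOdd.separating k
... | k , inj₂ refl = PositiveOdd.g k ∘ -_ , separating-neg (PositiveOdd.separating k)

_·_ : 𝓑 → 𝓑 → 𝓑
s · t = ⟨ ((fst t + snd t) ⊔ fst s) - snd t , snd s + snd t ∣ fst-nonneg , sum-nonneg ⟩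
  where
  fst-nonneg : + 0 ≤ ((fst t + snd t) ⊔ fst s) - snd t
  fst-nonneg = ℤ.i≤j⇒0≤j-i (ℤ.≤-trans (≤-by (fst t) (fst≥0 t) (ℤ.+-comm (fst t) (snd t))) (ℤ.i≤i⊔j _ (fst s)))
  telescope : ∀ y b d′ → y + b ≡ (y - d′) + (b + d′)
  telescope = solve-∀
  sum-nonneg : + 0 ≤ (((fst t + snd t) ⊔ fst s) - snd t) + (snd s + snd t)
  sum-nonneg = subst (+ 0 ≤_) (telescope ((fst t + snd t) ⊔ fst s) (snd s) (snd t))
                 (ℤ.≤-trans (sum≥0 s) (ℤ.+-monoˡ-≤ (snd s) (ℤ.i≤j⊔i (fst t + snd t) (fst s))))

absorbing-product : ∀ s t x → fst s ≤ fst t + snd t → fst x ≡ fst t → snd x ≡ snd s + snd t → IsProduct s t x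
absorbing-product s t x s≤t fst-x snd-x = cong₂ _,_ (trans fst-x (sym cancel)) snd-x
  where
  plus-minus : ∀ c y → (c + y) - y ≡ c
  plus-minus = solve-∀
  cancel : ((fst t + snd t) ⊔ fst s) - snd t ≡ fst t
  cancel = trans (cong (_- snd t) (ℤ.i≥j⇒i⊔j≡i s≤t)) (plus-minus (fst t) (snd t))

origin : 𝓑
origin = ⟨ + 0 , + 0 ∣ +≤+ ℕ.z≤n , +≤+ ℕ.z≤n ⟩

least : ℤ → 𝓑
least y = ⟨ + 0 ⊔ - y , y ∣ ℤ.i≤i⊔j (+ 0) (- y) , sum-nonneg ⟩
  where
  sum-nonneg : + 0 ≤ (+ 0 ⊔ - y) + y
  sum-nonneg = subst (_≤ (+ 0 ⊔ - y) + y) (ℤ.+-inverseˡ y) (ℤ.+-monoˡ-≤ y (ℤ.i≤j⊔i (+ 0) (- y)))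

-- fst (least b) ≤ c when c ≥ 0 and b + c ≥ 0, so least b · t is absorbing when
-- c = fst t + snd t.
least-absorbed : ∀ b c → + 0 ≤ c → + 0 ≤ b + c → fst (least b) ≤ c
least-absorbed b c c≥0 b+c≥0 = ℤ.⊔-lub c≥0 (≤-by (b + c) b+c≥0 (sym (cancel b c)))
  where
  cancel : ∀ b c → - b + (b + c) ≡ c
  cancel = solve-∀

unit-product : ∀ a b c y → + 0 ≤ a → + 0 ≤ c → + 0 ≤ c + y → mulℤ (a , b) (c , y) ≡ (+ 0 , + 0) →
               (a , b) ≡ (c , y) ⊎ ∃[ n ] (b ≡ -[1+ n ] × y ≡ + suc n)
unit-product a b c y a≥0 c≥0 c+y≥0 st≡0 = by-sign y c+y≥0 (subst (c + y ≤_) peak (ℤ.i≤i⊔j (c + y) a))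
                                                  (subst (a ≤_) peak (ℤ.i≤j⊔i (c + y) a)) (cong proj₂ st≡0)
  where
  peak : (c + y) ⊔ a ≡ y
  peak = ℤ.i-j≡0⇒i≡j _ _ (cong proj₁ st≡0)
  minus : ∀ b y → b ≡ (b + y) - y
  minus = solve-∀
  by-sign : ∀ y → + 0 ≤ c + y → c + y ≤ y → a ≤ y → b + y ≡ + 0 → (a , b) ≡ (c , y) ⊎ ∃[ n ] (b ≡ -[1+ n ] × y ≡ + suc n)
  by-sign -[1+ n ]  c+y≥0 c+y≤y _   _      with ℤ.≤-trans c+y≥0 c+y≤y
  ... | ()
  by-sign (+ zero)  _     c+0≤0 a≤0 b+0≡0 = inj₁ (cong₂ _,_ (trans (ℤ.≤-antisym a≤0 a≥0) (sym c≡0)) b≡0)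
    where
    c≡0 : c ≡ + 0
    c≡0 = ℤ.≤-antisym (subst (_≤ + 0) (ℤ.+-identityʳ c) c+0≤0) c≥0
    b≡0 : b ≡ + 0
    b≡0 = trans (sym (ℤ.+-identityʳ b)) b+0≡0
  by-sign (+ suc n) _     _     _   b+y≡0 = inj₂ (n , trans (minus b (+ suc n)) (cong (_- + suc n) b+y≡0) , refl)

separating-avoids : ∀ {d g} → Separating d g → Avoidable (U-odd d)
separating-avoids {d} {g} sep = g ∘ snd , avoids
  where
  open Separating sep
  difference : ∀ a b d → a + b ≡ d → b ≡ d - a
  difference a b _ refl = add-sub a b
    where
    add-sub : ∀ a b → b ≡ (a + b) - a
    add-sub = solve-∀
  avoids : (s t x : 𝓑) → pair s ≢ pair t → g (snd s) ≡ g (snd t) → IsProduct s t x → ¬ (x ∈ U-odd d)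
  avoids s t x s≢t same x≡st (inj₁ x≡0)
    with unit-product (fst s) (snd s) (fst t) (snd t) (fst≥0 s) (fst≥0 t) (sum≥0 t) (trans (sym x≡st) x≡0)
  ... | inj₁ s≡t              = s≢t s≡t
  ... | inj₂ (n , s≡-n , t≡n) =
    not-¬ refl (trans (sym same) (trans (cong g s≡-n) (trans (negate n) (cong (not ∘ g) (sym t≡n)))))
  avoids s t x s≢t same x≡st (inj₂ snd-x≡d) = not-¬ refl (trans same (trans (cong g t≡d-s) (reflect (snd s))))
    where
    t≡d-s : snd t ≡ d - snd s
    t≡d-s = difference (snd s) (snd t) d (trans (sym (cong proj₂ x≡st)) snd-x≡d)

module Maximality (d : ℤ) (d-odd : Odd d) (V : Subset) (U⊆V : U-odd d ⊆ V) (χ : 𝓑 → Bool)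
                  (avoids : (s t x : 𝓑) → pair s ≢ pair t → χ s ≡ χ t → IsProduct s t x → ¬ (x ∈ V)) where

  separated : ∀ s t x → IsProduct s t x → x ∈ V → pair s ≢ pair t → χ s ≢ χ t
  separated s t x x≡st x∈V s≢t same = avoids s t x s≢t same x≡st x∈V

  shift-distinct : ∀ b → b ≢ b + d
  shift-distinct b b≡b+d = double≢odd (+ 0) (proj₁ d-odd) (trans (sym d≡0) (proj₂ d-odd))
    where
    cancel : ∀ b d → (b + d) - b ≡ d
    cancel = solve-∀
    d≡0 : d ≡ + 0
    d≡0 = trans (sym (cancel b d)) (trans (cong (_- b) (sym b≡b+d)) (ℤ.+-inverseʳ b))

  -- Elements whose second coordinates sum to the odd number d are distinct, and
  -- their product lies in U.
  sum-d-separated : ∀ s t → snd s + snd t ≡ d → χ s ≢ χ t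
  sum-d-separated s t sum≡d = separated s t (s · t) refl (U⊆V (inj₂ sum≡d)) s≢t
    where
    s≢t : pair s ≢ pair t
    s≢t s≡t = double≢odd (snd s) (proj₁ d-odd)
                (trans (cong (λ y → snd s + y) (cong proj₂ s≡t)) (trans sum≡d (proj₂ d-odd)))

  -- least (-n) · least n = ⟨0 , 0⟩ for n > 0.
  unit-separated : ∀ n → χ (least -[1+ n ]) ≢ χ (least (+ suc n))
  unit-separated n = separated (least -[1+ n ]) (least (+ suc n)) origin
                       (absorbing-product (least -[1+ n ]) (least (+ suc n)) origin ℤ.≤-refl refl (sym (ℤ.+-inverseˡ (+ suc n))))
                       (U⊆V (inj₁ refl)) (λ ())

  colour-snd : ∀ s t → snd s ≡ snd t → χ s ≡ χ t
  colour-snd s t s≡t = both-differ (sum-d-separated s w (complement (snd s) d))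
                                   (sum-d-separated t w (subst (λ y → y + snd w ≡ d) s≡t (complement (snd s) d)))
    where
    w : 𝓑
    w = least (d - snd s)
    complement : ∀ y d → y + (d - y) ≡ d
    complement = solve-∀

  colour-shift : ∀ u v → snd u ≢ + 0 → snd v ≡ snd u + d → χ u ≡ χ v
  colour-shift u v u≢0 v≡u+d = both-differ u≢w v≢w
    where
    w : 𝓑
    w = least (- snd u)
    opposite : ∀ y → y ≢ + 0 → χ (least y) ≢ χ (least (- y))
    opposite (+ zero)  y≢0 = ⊥-elim (y≢0 refl)
    opposite (+ suc n) _   = ≢-sym (unit-separated n)
    opposite -[1+ n ]  _   = unit-separated n
    u≢w : χ u ≢ χ w
    u≢w = subst (_≢ χ w) (colour-snd (least (snd u)) u refl) (opposite (snd u) u≢0)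
    shifted : ∀ u d → (u + d) + - u ≡ d
    shifted = solve-∀
    v≢w : χ v ≢ χ w
    v≢w = sum-d-separated v w (trans (cong (_+ - snd u) v≡u+d) (shifted (snd u) d))

  -- Fix an element x = ⟨e , f⟩ of V.
  module _ (x : 𝓑) (x∈V : x ∈ V) where

    beside : ∀ b′ → + 0 ≤ fst x + b′ → 𝓑
    beside b′ e+b′≥0 = ⟨ fst x , b′ ∣ fst≥0 x , e+b′≥0 ⟩

    least-beside : ∀ b b′ (e+b′≥0 : + 0 ≤ fst x + b′) → snd x ≡ b + b′ → IsProduct (least b) (beside b′ e+b′≥0) x
    least-beside b b′ e+b′≥0 f≡b+b′ = absorbing-product (least b) (beside b′ e+b′≥0) x
      (least-absorbed b (fst x + b′) e+b′≥0 (subst (+ 0 ≤_) (trans (cong (λ y → fst x + y) f≡b+b′) (swap (fst x) b b′)) (sum≥0 x)))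
      refl f≡b+b′
      where
      swap : ∀ e b b′ → e + (b + b′) ≡ b + (e + b′)
      swap = solve-∀

    -- If f = 2b then e + b ≥ 0, since 2(e + b) = e + (e + f).
    half-sum : ∀ b → snd x ≡ b + b → + 0 ≤ fst x + b
    half-sum b f≡2b = half-nonneg (fst x + b)
      (subst (+ 0 ≤_) (trans (cong (λ y → fst x + (fst x + y)) f≡2b) (regroup (fst x) b)) (ℤ.+-mono-≤ (fst≥0 x) (sum≥0 x)))
      where
      regroup : ∀ e b → e + (e + (b + b)) ≡ (e + b) + (e + b)
      regroup = solve-∀

    -- An even second coordinate f = 2b forces x = ⟨0 , 0⟩: otherwise x is a
    -- product of two distinct elements with second coordinate b.
    even-in-U : ∀ b → snd x ≡ b + b → pair x ≡ (+ 0 , + 0)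
    even-in-U b f≡2b with fst x ≟ fst (least b)
    ... | no e≢ℓ = ⊥-elim (separated (least b) t x (least-beside b b (half-sum b f≡2b) f≡2b) x∈V
                                      (e≢ℓ ∘ sym ∘ cong proj₁) (colour-snd (least b) t refl))
      where
      t : 𝓑
      t = beside b (half-sum b f≡2b)
    ... | yes e≡ℓ with b ≟ + 0
    ...   | yes refl = cong₂ _,_ e≡ℓ f≡2b
    ...   | no b≢0  = ⊥-elim (separated s (least b) x s·ℓ≡x x∈V s≢ℓ (colour-snd s (least b) refl))
      where
      s : 𝓑
      s = ⟨ fst x + b , b ∣ half-sum b f≡2b , subst (+ 0 ≤_) (trans (cong (λ y → fst x + y) f≡2b) (sym (ℤ.+-assoc (fst x) b b))) (sum≥0 x) ⟩
      s·ℓ≡x : IsProduct s (least b) x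
      s·ℓ≡x = absorbing-product s (least b) x (ℤ.≤-reflexive (cong (_+ b) e≡ℓ)) e≡ℓ f≡2b
      cancel : ∀ e b → (e + b) - e ≡ b
      cancel = solve-∀
      s≢ℓ : pair s ≢ pair (least b)
      s≢ℓ s≡ℓ = b≢0 (trans (sym (cancel (fst x) b))
                           (trans (cong (_- fst x) (trans (cong proj₁ s≡ℓ) (sym e≡ℓ))) (ℤ.+-inverseʳ (fst x))))

    -- A second coordinate f = 2b + d forces b = 0: otherwise x is a product of
    -- elements with second coordinates b and b + d, in one order or the other.
    odd-in-U : ∀ b → snd x ≡ b + (b + d) → b ≡ + 0
    odd-in-U b f≡ with b ≟ + 0
    ... | yes b≡0 = b≡0
    ... | no b≢0 with + 0 ≤? fst x + (b + d)
    ...   | yes e+b+d≥0 = ⊥-elim (separated (least b) t x (least-beside b (b + d) e+b+d≥0 f≡) x∈V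
                                            (shift-distinct b ∘ cong proj₂) (colour-shift (least b) t b≢0 refl))
      where
      t : 𝓑
      t = beside (b + d) e+b+d≥0
    ...   | no e+b+d≱0 = ⊥-elim (separated (least (b + d)) t x (least-beside (b + d) b e+b≥0 f≡′) x∈V
                                           (≢-sym (shift-distinct b) ∘ cong proj₂) (sym (colour-shift t (least (b + d)) b≢0 refl)))
      where
      regroup : ∀ e b d → (e + (e + (b + (b + d)))) + - (e + (b + d)) ≡ e + b
      regroup = solve-∀
      e+b≥0 : + 0 ≤ fst x + b
      e+b≥0 = subst (+ 0 ≤_) (trans (cong (λ y → (fst x + (fst x + y)) + - (fst x + (b + d))) f≡) (regroup (fst x) b d))
                (ℤ.+-mono-≤ (ℤ.+-mono-≤ (fst≥0 x) (sum≥0 x)) (ℤ.neg-mono-≤ (ℤ.<⇒≤ (ℤ.≰⇒> e+b+d≱0))))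
      t : 𝓑
      t = beside b e+b≥0
      f≡′ : snd x ≡ (b + d) + b
      f≡′ = trans f≡ (ℤ.+-comm b (b + d))

    V⊆U : x ∈ U-odd d
    V⊆U with halve d d-odd (snd x)
    ... | b , inj₁ f≡2b   = inj₁ (even-in-U b f≡2b)
    ... | b , inj₂ f≡2b+d = inj₂ (begin
      snd x              ≡⟨ f≡2b+d ⟩
      b + (b + d)        ≡⟨ cong (λ y → y + (y + d)) (odd-in-U b f≡2b+d) ⟩
      + 0 + (+ 0 + d)    ≡⟨ ℤ.+-identityˡ (+ 0 + d) ⟩
      + 0 + d            ≡⟨ ℤ.+-identityˡ d ⟩
      d                  ∎)
      where open ≡-Reasoning

mainTheorem19 : (d : ℤ) → Odd d → MaximalAvoidable (U-odd d)
mainTheorem19 d d-odd = separating-avoids (proj₂ (separating d d-odd)) , maximal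
  where
  maximal : (V : Subset) → U-odd d ⊆ V → Avoidable V → V ⊆ U-odd d
  maximal V U⊆V (χ , avoids) {x} x∈V = Maximality.V⊆U d d-odd V U⊆V χ avoids x x∈V
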